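{- Let $\alpha$ be an integer with $0\le\alpha\le 652$, let $\beta\in\{1,2\}$, and let $Q=(x^4-y^4)^{\alpha}(x^8+14x^4y^4+y^8)^{\beta}\in\mathbb{Z}[x,y]$. (1) If $\beta=1$ and for some integer $i$ with $0\le i\le \frac{\alpha+2}{2}$ the coefficient of the monomial $x^{4(\alpha+2-i)}y^{4i}$ in $Q$ equals $0$, then $(\alpha,i)\in\{(14,1),(223,15)\}$. (2) If $\beta=2$ and for some integer $i$ with $0\le i\le \frac{\alpha+4}{2}$ the coefficient of the monomial $x^{4(\alpha+4-i)}y^{4i}$ in $Q$ equals $0$, then $(\alpha,i)=(28,1)$. -}

module Defs where

open import Data.Nat as ℕ using (ℕ; zero; suc; _≡ᵇ_)
open import Data.Integer as ℤ using (ℤ; +_; -_)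
open import Data.Bool using (_∧_; if_then_else_)
open import Data.List using (List; []; _∷_; _++_; map; concatMap; foldr)
open import Data.Product using (_×_; _,_)

-- Polynomials in ℤ[x,y], represented as formal finite sums of terms.
-- A term (j , k , c) stands for the monomial c · x^j · y^k.
-- A list of terms stands for their sum (duplicates allowed; the
-- polynomial is determined by the coefficient function `coeff`).
Term : Set
Term = ℕ × ℕ × ℤ

Poly2 : Set
Poly2 = List Term

mono : ℤ → ℕ → ℕ → Poly2
mono c j k = (j , k , c) ∷ []

one : Poly2
one = mono (+ 1) 0 0

infixl 6 _+ₚ_
infixl 7 _*ₚ_
infixr 8 _^ₚ_

_+ₚ_ : Poly2 → Poly2 → Poly2
p +ₚ q = p ++ q

mulTerm : Term → Term → Term
mulTerm (j , k , c) (j' , k' , c') = (j ℕ.+ j' , k ℕ.+ k' , c ℤ.* c')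

_*ₚ_ : Poly2 → Poly2 → Poly2
p *ₚ q = concatMap (λ t → map (mulTerm t) q) p

_^ₚ_ : Poly2 → ℕ → Poly2
p ^ₚ zero = one
p ^ₚ suc n = p *ₚ (p ^ₚ n)

coeff : ℕ → ℕ → Poly2 → ℤ
coeff j k = foldr (λ { (a , b , c) acc → if (a ≡ᵇ j) ∧ (b ≡ᵇ k) then c ℤ.+ acc else acc }) (+ 0)

P₁ : Poly2
P₁ = mono (+ 1) 4 0 +ₚ mono (- (+ 1)) 0 4

P₂ : Poly2
P₂ = mono (+ 1) 8 0 +ₚ mono (+ 14) 4 4 +ₚ mono (+ 1) 0 8

Q : ℕ → ℕ → Poly2
Q α β = (P₁ ^ₚ α) *ₚ (P₂ ^ₚ β)

module Submission where

-- Call the coefficients of x^{4a} y^{4b} with a + b = d the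
-- diagonal of a polynomial in degree 4d, read as a row (r₀, …, r_d) indexed
-- by b.  Multiplying by x⁴ − y⁴ acts on diagonals as a difference operator:
-- the new row in degree 4(d+1) has entries r_b − r_{b−1} (with r_{−1} = 0
-- and r_{d+1} = 0).  The diagonal of (x⁸ + 14x⁴y⁴ + y⁸)^β is (1, 14, 1) for
-- β = 1 and (1, 28, 198, 28, 1) for β = 2, so the diagonal of Q α β is the
-- α-fold difference of that row, and the coefficients in the theorem are
-- its entries in positions i with 2i ≤ α + 2β.
--
-- The theorem is then the
-- soundness lemma applied to the two base rows, the certificate being
-- checked by evaluation.

open import Defs
open import Data.Nat using (ℕ; zero; suc; _+_; _*_; _∸_; _≤_; _<_; _≡ᵇ_; s≤s; _≤?_)
import Data.Nat as ℕ
import Data.Nat.Properties as ℕₚ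
open import Data.Integer using (ℤ; +_; -_)
import Data.Integer as ℤ
import Data.Integer.Properties as ℤₚ
open import Data.Bool using (Bool; true; false; T; _∧_)
open import Data.Bool.Properties using (∧-zeroʳ; T-∧)
open import Data.List using (List; []; _∷_; _++_; map; length)
import Data.List.Properties as Listₚ
open import Data.Product using (_×_; _,_; proj₁; proj₂)
open import Data.Product.Properties using (≡-dec)
open import Data.Sum using (_⊎_)
open import Data.Unit using (tt)
open import Function.Bundles using (Equivalence)
open import Relation.Nullary.Decidable using (Dec; ⌊_⌋; toWitness; _⊎-dec_; _→-dec_)
open import Relation.Binary.PropositionalEquality
  using (_≡_; refl; sym; trans; cong; cong₂; subst; module ≡-Reasoning)

coeff-++ : ∀ j k (p q : Poly2) → coeff j k (p ++ q) ≡ coeff j k p ℤ.+ coeff j k q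
coeff-++ j k [] q = sym (ℤₚ.+-identityˡ _)
coeff-++ j k ((a , b , c) ∷ p) q with (a ≡ᵇ j) ∧ (b ≡ᵇ k)
... | true = trans (cong (λ v → c ℤ.+ v) (coeff-++ j k p q)) (sym (ℤₚ.+-assoc c _ _))
... | false = coeff-++ j k p q

≡ᵇ-+ˡ : ∀ a m n → (a + m ≡ᵇ a + n) ≡ (m ≡ᵇ n)
≡ᵇ-+ˡ zero m n = refl
≡ᵇ-+ˡ (suc a) m n = ≡ᵇ-+ˡ a m n

coeff-shift : ∀ a b c j k (S : Poly2) →
  coeff (a + j) (b + k) (map (mulTerm (a , b , c)) S) ≡ c ℤ.* coeff j k S
coeff-shift a b c j k [] = sym (ℤₚ.*-zeroʳ c)
coeff-shift a b c j k ((x , y , z) ∷ S) rewrite ≡ᵇ-+ˡ a x j | ≡ᵇ-+ˡ b y k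
  with (x ≡ᵇ j) ∧ (y ≡ᵇ k)
... | true = trans (cong (λ v → c ℤ.* z ℤ.+ v) (coeff-shift a b c j k S)) (sym (ℤₚ.*-distribˡ-+ c z _))
... | false = coeff-shift a b c j k S

coeff-x-free : ∀ a b c k (S : Poly2) → coeff 0 k (map (mulTerm (suc a , b , c)) S) ≡ + 0
coeff-x-free a b c k [] = refl
coeff-x-free a b c k (_ ∷ S) = coeff-x-free a b c k S

coeff-y-free : ∀ a b c j (S : Poly2) → coeff j 0 (map (mulTerm (a , suc b , c)) S) ≡ + 0
coeff-y-free a b c j [] = refl
coeff-y-free a b c j ((x , _ , _) ∷ S) rewrite ∧-zeroʳ (a + x ≡ᵇ j) = coeff-y-free a b c j S

coeff-one-* : ∀ j k (S : Poly2) → coeff j k (one *ₚ S) ≡ coeff j k S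
coeff-one-* j k S = begin
    coeff j k (map (mulTerm (0 , 0 , + 1)) S ++ [])
  ≡⟨ coeff-++ j k (map (mulTerm (0 , 0 , + 1)) S) [] ⟩
    coeff j k (map (mulTerm (0 , 0 , + 1)) S) ℤ.+ + 0
  ≡⟨ ℤₚ.+-identityʳ _ ⟩
    coeff j k (map (mulTerm (0 , 0 , + 1)) S)
  ≡⟨ coeff-shift 0 0 (+ 1) j k S ⟩
    + 1 ℤ.* coeff j k S
  ≡⟨ ℤₚ.*-identityˡ _ ⟩
    coeff j k S
  ∎
  where open ≡-Reasoning

-- Associativity of multiplication, needed to peel one factor x⁴ − y⁴ off
-- (x⁴ − y⁴)^{α+1} · S.  It holds on the nose for term lists.
mulTerm-assoc : ∀ t s u → mulTerm (mulTerm t s) u ≡ mulTerm t (mulTerm s u)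
mulTerm-assoc (a , b , c) (a' , b' , c') (a'' , b'' , c'')
  rewrite ℕₚ.+-assoc a a' a'' | ℕₚ.+-assoc b b' b'' | ℤₚ.*-assoc c c' c'' = refl

map-mulTerm-*ₚ : ∀ t (S R : Poly2) → map (mulTerm t) S *ₚ R ≡ map (mulTerm t) (S *ₚ R)
map-mulTerm-*ₚ t [] R = refl
map-mulTerm-*ₚ t (s ∷ S) R = begin
    map (mulTerm (mulTerm t s)) R ++ map (mulTerm t) S *ₚ R
  ≡⟨ cong₂ _++_ (trans (Listₚ.map-cong (mulTerm-assoc t s) R) (Listₚ.map-∘ R)) (map-mulTerm-*ₚ t S R) ⟩
    map (mulTerm t) (map (mulTerm s) R) ++ map (mulTerm t) (S *ₚ R)
  ≡⟨ sym (Listₚ.map-++ (mulTerm t) (map (mulTerm s) R) (S *ₚ R)) ⟩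
    map (mulTerm t) (map (mulTerm s) R ++ S *ₚ R)
  ∎
  where open ≡-Reasoning

*ₚ-distribʳ-++ : ∀ (A B R : Poly2) → (A ++ B) *ₚ R ≡ A *ₚ R ++ B *ₚ R
*ₚ-distribʳ-++ [] B R = refl
*ₚ-distribʳ-++ (a ∷ A) B R =
  trans (cong (map (mulTerm a) R ++_) (*ₚ-distribʳ-++ A B R))
        (sym (Listₚ.++-assoc (map (mulTerm a) R) (A *ₚ R) (B *ₚ R)))

*ₚ-assoc : ∀ (p q r : Poly2) → (p *ₚ q) *ₚ r ≡ p *ₚ (q *ₚ r)
*ₚ-assoc [] q r = refl
*ₚ-assoc (t ∷ p) q r = begin
    (map (mulTerm t) q ++ p *ₚ q) *ₚ r
  ≡⟨ *ₚ-distribʳ-++ (map (mulTerm t) q) (p *ₚ q) r ⟩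
    map (mulTerm t) q *ₚ r ++ (p *ₚ q) *ₚ r
  ≡⟨ cong₂ _++_ (map-mulTerm-*ₚ t q r) (*ₚ-assoc p q r) ⟩
    map (mulTerm t) (q *ₚ r) ++ p *ₚ (q *ₚ r)
  ∎
  where open ≡-Reasoning

x⁴* y⁴* : Poly2 → Poly2
x⁴* = map (mulTerm (4 , 0 , + 1))
y⁴* = map (mulTerm (0 , 4 , - (+ 1)))

coeff-P₁-* : ∀ j k (S : Poly2) → coeff j k (P₁ *ₚ S) ≡ coeff j k (x⁴* S) ℤ.+ coeff j k (y⁴* S)
coeff-P₁-* j k S = begin
    coeff j k (x⁴* S ++ (y⁴* S ++ []))
  ≡⟨ coeff-++ j k (x⁴* S) (y⁴* S ++ []) ⟩
    coeff j k (x⁴* S) ℤ.+ coeff j k (y⁴* S ++ [])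
  ≡⟨ cong (λ v → coeff j k (x⁴* S) ℤ.+ v) (trans (coeff-++ j k (y⁴* S) []) (ℤₚ.+-identityʳ _)) ⟩
    coeff j k (x⁴* S) ℤ.+ coeff j k (y⁴* S)
  ∎
  where open ≡-Reasoning

coeff-x⁴* : ∀ a k (S : Poly2) → coeff (4 * suc a) k (x⁴* S) ≡ coeff (4 * a) k S
coeff-x⁴* a k S rewrite ℕₚ.*-suc 4 a =
  trans (coeff-shift 4 0 (+ 1) (4 * a) k S) (ℤₚ.*-identityˡ _)

coeff-y⁴* : ∀ j b (S : Poly2) → coeff j (4 * suc b) (y⁴* S) ≡ - coeff j (4 * b) S
coeff-y⁴* j b S rewrite ℕₚ.*-suc 4 b =
  trans (coeff-shift 0 4 (- (+ 1)) j (4 * b) S) (ℤₚ.-1*i≡-i _)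

entry : List ℤ → ℕ → ℤ
entry [] _ = + 0
entry (x ∷ _) zero = x
entry (_ ∷ r) (suc m) = entry r m

entry-beyond : ∀ r m → length r ≤ m → entry r m ≡ + 0
entry-beyond [] m _ = refl
entry-beyond (_ ∷ r) (suc m) (s≤s h) = entry-beyond r m h

-- The difference operator (Δr)_b = r_b − r_{b−1}, where r_{−1} = 0;
-- differenceFrom p r computes it with p in the role of r_{−1}.
differenceFrom : ℤ → List ℤ → List ℤ
differenceFrom p [] = - p ∷ []
differenceFrom p (x ∷ r) = x ℤ.- p ∷ differenceFrom x r

difference : List ℤ → List ℤ
difference = differenceFrom (+ 0)

length-differenceFrom : ∀ p r → length (differenceFrom p r) ≡ suc (length r)
length-differenceFrom p [] = refl
length-differenceFrom p (x ∷ r) = cong suc (length-differenceFrom x r)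

entry-differenceFrom-zero : ∀ p r → entry (differenceFrom p r) 0 ≡ entry r 0 ℤ.- p
entry-differenceFrom-zero p [] = sym (ℤₚ.+-identityˡ (- p))
entry-differenceFrom-zero p (x ∷ r) = refl

entry-differenceFrom-suc : ∀ p r m → entry (differenceFrom p r) (suc m) ≡ entry r (suc m) ℤ.- entry r m
entry-differenceFrom-suc p [] m = refl
entry-differenceFrom-suc p (x ∷ r) zero = entry-differenceFrom-zero x r
entry-differenceFrom-suc p (x ∷ r) (suc m) = entry-differenceFrom-suc x r m

differences : ℕ → List ℤ → List ℤ
differences zero r = r
differences (suc α) r = difference (differences α r)

record Diagonal (d : ℕ) (S : Poly2) (r : List ℤ) : Set where
  field
    row-length : length r ≡ suc d
    diagonal-coeff : ∀ a b → a + b ≡ d → coeff (4 * a) (4 * b) S ≡ entry r b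

diagonal-P₁-* : ∀ {d S r} → Diagonal d S r → Diagonal (suc d) (P₁ *ₚ S) (difference r)
diagonal-P₁-* {d} {S} {r} D = record
  { row-length = trans (length-differenceFrom (+ 0) r) (cong suc row-length)
  ; diagonal-coeff = coeffs
  }
  where
  open Diagonal D
  open ≡-Reasoning

  coeffs : ∀ a b → a + b ≡ suc d → coeff (4 * a) (4 * b) (P₁ *ₚ S) ≡ entry (difference r) b
  coeffs zero zero ()
  coeffs (suc a) zero e = begin
      coeff (4 * suc a) 0 (P₁ *ₚ S)
    ≡⟨ coeff-P₁-* (4 * suc a) 0 S ⟩
      coeff (4 * suc a) 0 (x⁴* S) ℤ.+ coeff (4 * suc a) 0 (y⁴* S)
    ≡⟨ cong₂ ℤ._+_ (coeff-x⁴* a 0 S) (coeff-y-free 0 3 (- (+ 1)) (4 * suc a) S) ⟩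
      coeff (4 * a) 0 S ℤ.+ + 0
    ≡⟨ cong (ℤ._+ + 0) (diagonal-coeff a 0 (ℕₚ.suc-injective e)) ⟩
      entry r 0 ℤ.- + 0
    ≡⟨ sym (entry-differenceFrom-zero (+ 0) r) ⟩
      entry (difference r) 0
    ∎
  coeffs zero (suc b) e = begin
      coeff 0 (4 * suc b) (P₁ *ₚ S)
    ≡⟨ coeff-P₁-* 0 (4 * suc b) S ⟩
      coeff 0 (4 * suc b) (x⁴* S) ℤ.+ coeff 0 (4 * suc b) (y⁴* S)
    ≡⟨ cong₂ ℤ._+_ (coeff-x-free 3 0 (+ 1) (4 * suc b) S) (coeff-y⁴* 0 b S) ⟩
      + 0 ℤ.- coeff 0 (4 * b) S
    ≡⟨ cong₂ ℤ._-_ (sym (entry-beyond r (suc b) r≤)) (diagonal-coeff 0 b b≡d) ⟩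
      entry r (suc b) ℤ.- entry r b
    ≡⟨ sym (entry-differenceFrom-suc (+ 0) r b) ⟩
      entry (difference r) (suc b)
    ∎
    where
    b≡d : b ≡ d
    b≡d = ℕₚ.suc-injective e
    r≤ : length r ≤ suc b
    r≤ = ℕₚ.≤-reflexive (trans row-length (cong suc (sym b≡d)))
  coeffs (suc a) (suc b) e = begin
      coeff (4 * suc a) (4 * suc b) (P₁ *ₚ S)
    ≡⟨ coeff-P₁-* (4 * suc a) (4 * suc b) S ⟩
      coeff (4 * suc a) (4 * suc b) (x⁴* S) ℤ.+ coeff (4 * suc a) (4 * suc b) (y⁴* S)
    ≡⟨ cong₂ ℤ._+_ (coeff-x⁴* a (4 * suc b) S) (coeff-y⁴* (4 * suc a) b S) ⟩
      coeff (4 * a) (4 * suc b) S ℤ.- coeff (4 * suc a) (4 * b) S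
    ≡⟨ cong₂ ℤ._-_ (diagonal-coeff a (suc b) (ℕₚ.suc-injective e))
                   (diagonal-coeff (suc a) b (trans (sym (ℕₚ.+-suc a b)) (ℕₚ.suc-injective e))) ⟩
      entry r (suc b) ℤ.- entry r b
    ≡⟨ sym (entry-differenceFrom-suc (+ 0) r b) ⟩
      entry (difference r) (suc b)
    ∎

diagonal-P₁^-* : ∀ α {d S r} → Diagonal d S r → Diagonal (α + d) (P₁ ^ₚ α *ₚ S) (differences α r)
diagonal-P₁^-* zero {S = S} D = record
  { row-length = row-length
  ; diagonal-coeff = λ a b e → trans (coeff-one-* (4 * a) (4 * b) S) (diagonal-coeff a b e)
  }
  where open Diagonal D
diagonal-P₁^-* (suc α) {S = S} D =
  subst (λ T → Diagonal _ T _) (sym (*ₚ-assoc P₁ (P₁ ^ₚ α) S)) (diagonal-P₁-* (diagonal-P₁^-* α D))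

diagonal-P₂ : Diagonal 2 (P₂ ^ₚ 1) (+ 1 ∷ + 14 ∷ + 1 ∷ [])
diagonal-P₂ = record { row-length = refl ; diagonal-coeff = coeffs }
  where
  coeffs : ∀ a b → a + b ≡ 2 → coeff (4 * a) (4 * b) (P₂ ^ₚ 1) ≡ entry (+ 1 ∷ + 14 ∷ + 1 ∷ []) b
  coeffs 0 .2 refl = refl
  coeffs 1 .1 refl = refl
  coeffs 2 .0 refl = refl
  coeffs (suc (suc (suc a))) b ()

diagonal-P₂² : Diagonal 4 (P₂ ^ₚ 2) (+ 1 ∷ + 28 ∷ + 198 ∷ + 28 ∷ + 1 ∷ [])
diagonal-P₂² = record { row-length = refl ; diagonal-coeff = coeffs }
  where
  coeffs : ∀ a b → a + b ≡ 4 → coeff (4 * a) (4 * b) (P₂ ^ₚ 2) ≡ entry (+ 1 ∷ + 28 ∷ + 198 ∷ + 28 ∷ + 1 ∷ []) b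
  coeffs 0 .4 refl = refl
  coeffs 1 .3 refl = refl
  coeffs 2 .2 refl = refl
  coeffs 3 .1 refl = refl
  coeffs 4 .0 refl = refl
  coeffs (suc (suc (suc (suc (suc a))))) b ()

-- A Boolean certificate for: "in the rows α = 0, …, n − 1, every vanishing
-- entry in a position i with 2i ≤ α + e is allowed", where row α is the
-- diagonal of (x⁴ − y⁴)^α S in degree 4(α + e).  The rows are produced by
-- repeated differencing, so the check walks through them in one pass.
module Certificate (Allowed : ℕ → ℕ → Set) (allowed? : ∀ α i → Dec (Allowed α i)) (e : ℕ) where

  Admissible : ℕ → ℕ → ℤ → Set
  Admissible α i x = 2 * i ≤ α + e → x ≡ + 0 → Allowed α i

  admissible? : ∀ α i x → Dec (Admissible α i x)
  admissible? α i x = (2 * i ≤? α + e) →-dec (x ℤ.≟ + 0) →-dec allowed? α i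

  -- check row α, whose first listed entry sits in position m
  rowOK : ℕ → ℕ → List ℤ → Bool
  rowOK α m [] = true
  rowOK α m (x ∷ r) = ⌊ admissible? α m x ⌋ ∧ rowOK α (suc m) r

  rowOK-sound : ∀ α m r i → T (rowOK α m r) → i < length r → Admissible α (m + i) (entry r i)
  rowOK-sound α m (x ∷ r) zero ok _ =
    subst (λ n → Admissible α n x) (sym (ℕₚ.+-identityʳ m))
      (toWitness (proj₁ (Equivalence.to (T-∧ {⌊ admissible? α m x ⌋}) ok)))
  rowOK-sound α m (x ∷ r) (suc i) ok (s≤s i<) =
    subst (λ n → Admissible α n (entry r i)) (sym (ℕₚ.+-suc m i))
      (rowOK-sound α (suc m) r i (proj₂ (Equivalence.to (T-∧ {⌊ admissible? α m x ⌋}) ok)) i<)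

  rowsOK : ℕ → List ℤ → ℕ → Bool
  rowsOK α r zero = true
  rowsOK α r (suc n) = rowOK α 0 r ∧ rowsOK (suc α) (difference r) n

  rowsOK-sound : ∀ α r n k → T (rowsOK α (differences α r) n) → k < n →
    T (rowOK (α + k) 0 (differences (α + k) r))
  rowsOK-sound α r (suc n) zero ok _ =
    subst (λ β → T (rowOK β 0 (differences β r))) (sym (ℕₚ.+-identityʳ α))
      (proj₁ (Equivalence.to (T-∧ {rowOK α 0 (differences α r)}) ok))
  rowsOK-sound α r (suc n) (suc k) ok (s≤s k<) =
    subst (λ β → T (rowOK β 0 (differences β r))) (sym (ℕₚ.+-suc α k))
      (rowsOK-sound (suc α) r n k (proj₂ (Equivalence.to (T-∧ {rowOK α 0 (differences α r)}) ok)) k<)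

  vanishing-coeff : ∀ {S r} n → Diagonal e S r → T (rowsOK 0 r n) →
    ∀ α → α < n → ∀ i → 2 * i ≤ α + e →
    coeff (4 * (α + e ∸ i)) (4 * i) (P₁ ^ₚ α *ₚ S) ≡ + 0 → Allowed α i
  vanishing-coeff {r = r} n D ok α α<n i upper vanishes =
    rowOK-sound α 0 (differences α r) i (rowsOK-sound 0 r n α ok α<n) i<length upper
      (trans (sym (diagonal-coeff (α + e ∸ i) i (ℕₚ.m∸n+n≡m i≤))) vanishes)
    where
    open Diagonal (diagonal-P₁^-* α D)
    i≤ : i ≤ α + e
    i≤ = ℕₚ.≤-trans (ℕₚ.m≤m+n i (i + 0)) upper
    i<length : i < length (differences α r)
    i<length = subst (i <_) (sym row-length) (s≤s i≤)

Exception₁ Exception₂ : ℕ → ℕ → Set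
Exception₁ α i = ((α , i) ≡ (14 , 1)) ⊎ ((α , i) ≡ (223 , 15))
Exception₂ α i = (α , i) ≡ (28 , 1)

exception₁? : ∀ α i → Dec (Exception₁ α i)
exception₁? α i = pair≟ (α , i) (14 , 1) ⊎-dec pair≟ (α , i) (223 , 15)
  where pair≟ = ≡-dec ℕ._≟_ ℕ._≟_

exception₂? : ∀ α i → Dec (Exception₂ α i)
exception₂? α i = ≡-dec ℕ._≟_ ℕ._≟_ (α , i) (28 , 1)

lemma2p6 : (α : ℕ) → α ≤ 652 →
    ((i : ℕ) → 2 * i ≤ α + 2 → coeff (4 * (α + 2 ∸ i)) (4 * i) (Q α 1) ≡ + 0 →
      ((α , i) ≡ (14 , 1)) ⊎ ((α , i) ≡ (223 , 15)))
    × ((i : ℕ) → 2 * i ≤ α + 4 → coeff (4 * (α + 4 ∸ i)) (4 * i) (Q α 2) ≡ + 0 →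
      (α , i) ≡ (28 , 1))
-- Q α β = (x⁴ − y⁴)^α P₂^β; the two certificates, for the 653 rows
-- α = 0, …, 652, are verified by evaluation (the proof tt).
lemma2p6 α α≤652 =
  Certificate.vanishing-coeff Exception₁ exception₁? 2 653 diagonal-P₂ tt α (s≤s α≤652) ,
  Certificate.vanishing-coeff Exception₂ exception₂? 4 653 diagonal-P₂² tt α (s≤s α≤652)
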